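{- Let $\tau$ be a permutation of size $n\ge 1$. Then there exists a permutation $\pi$ of size $n$ with $T(\pi)=\tau$ if and only if every pair $(R_i,R_{i+1})$ of adjacent runs of $\tau$ satisfies $\min(R_i)<\max(R_{i+1})$.
   Context: Permutations are written in one-line notation $\pi=a_1a_2\ldots a_n$. A descent is an index $i$ with $a_i>a_{i+1}$, an ascent an index $i$ with $a_i<a_{i+1}$. The descents split $\pi$ into runs (maximal increasing strings of consecutive entries) and the ascents split $\pi$ into falls (maximal decreasing strings of consecutive entries). The flip $T$ is the map sending a permutation $\pi$ to the permutation obtained by reversing every fall of $\pi$ in place (e.g. $T(3276145)=2316745$). A permutation in the image of $T$ is called pop-stacked. A pair of adjacent runs $(R_i,R_{i+1})$ with $\min(R_i)<\max(R_{i+1})$ is called overlapping. -}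

module Defs where

open import Data.Nat using (ℕ; zero; suc; _<_; _<?_; _⊓_; _⊔_)
open import Data.Bool using (Bool; if_then_else_)
open import Data.List using (List; []; _∷_; [_]; map; upTo; concat; reverse; foldr)
open import Data.List.Relation.Binary.Permutation.Propositional using (_↭_)
open import Data.Product using (_×_)
open import Data.Unit using (⊤)
open import Relation.Nullary.Decidable using (⌊_⌋)

-- A permutation of size n in one-line notation: a list that is a
-- rearrangement of 1,2,...,n.
IsPerm : ℕ → List ℕ → Set
IsPerm n xs = xs ↭ map suc (upTo n)

-- Split a list into maximal blocks of consecutive entries, where two
-- consecutive entries a b stay in the same block iff  rel a b  holds.
private
  consFirst : ℕ → List (List ℕ) → List (List ℕ)
  consFirst x []       = [ x ] ∷ []
  consFirst x (g ∷ gs) = (x ∷ g) ∷ gs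

  splitAux : (ℕ → ℕ → Bool) → ℕ → List ℕ → List (List ℕ)
  splitAux rel x []       = [ x ] ∷ []
  splitAux rel x (y ∷ ys) =
    if rel x y then consFirst x (splitAux rel y ys)
               else [ x ] ∷ splitAux rel y ys

splitBy : (ℕ → ℕ → Bool) → List ℕ → List (List ℕ)
splitBy rel []       = []
splitBy rel (x ∷ xs) = splitAux rel x xs

runs : List ℕ → List (List ℕ)
runs = splitBy (λ a b → ⌊ a <? b ⌋)

falls : List ℕ → List (List ℕ)
falls = splitBy (λ a b → ⌊ b <? a ⌋)

T : List ℕ → List ℕ
T π = concat (map reverse (falls π))

-- Minimum and maximum of a (nonempty) list; the empty list gets 0,
-- which never occurs for runs.
minL : List ℕ → ℕ
minL []       = 0
minL (x ∷ xs) = foldr _⊓_ x xs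

maxL : List ℕ → ℕ
maxL []       = 0
maxL (x ∷ xs) = foldr _⊔_ x xs

AllAdjacent : {A : Set} → (A → A → Set) → List A → Set
AllAdjacent P []             = ⊤
AllAdjacent P (x ∷ [])       = ⊤
AllAdjacent P (x ∷ y ∷ rest) = P x y × AllAdjacent P (y ∷ rest)

AllRunsOverlapping : List ℕ → Set
AllRunsOverlapping τ = AllAdjacent (λ R R′ → minL R < maxL R′) (runs τ)

module Submission where

-- Reversal exchanges increasing and
-- decreasing blocks, and for an increasing block min/max are its first and
-- last entry, so "overlapping" means  head R < last R′.
--   (⇐) Put π = reverse R₁ ⋯ reverse Rₖ.  Overlap makes every junction of
--       π an ascent, so the falls of π are exactly the reversed runs, and
--       T π = R₁ ⋯ Rₖ = τ.  Hence the increasing blocks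
--       Bᵢ = reverse Fᵢ satisfy head Bᵢ < last Bᵢ₊₁, and an induction over
--       the blocks shows that the runs of T π = B₁ ⋯ Bₘ (each run a union of
--       consecutive blocks) inherit this property.

open import Defs
open import Data.Nat using (ℕ; _≤_)
open import Data.List using (List)
open import Data.Product using (∃; _×_)
open import Relation.Binary.PropositionalEquality using (_≡_)
open import Function.Bundles using (_⇔_)

open import Data.Nat using (_<_; _<?_; _⊓_)
open import Data.Nat.Properties
  using (≤-refl; ≤-trans; ≤-antisym; <⇒≤; <-≤-trans; ≤-<-trans; <⇒≯; ≮⇒≥; ≤∧≢⇒<;
         m≥n⇒m⊓n≡n; m≤m⊔n; m≤n⊔m; ⊔-lub; suc-injective)
open import Data.Bool using (Bool; true; false)
open import Data.List using ([]; _∷_; [_]; _++_; concat; map; reverse; foldr)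
open import Data.List.Properties using (reverse-involutive; unfold-reverse; ++-identityʳ)
open import Data.List.Membership.Propositional using (_∈_)
open import Data.List.Relation.Unary.Any using (here; there)
open import Data.List.Relation.Unary.All as All using (All; []; _∷_)
open import Data.List.Relation.Unary.AllPairs using ([]; _∷_)
open import Data.List.Relation.Binary.Permutation.Propositional using (_↭_; ↭-refl; ↭-sym; ↭-trans; ↭⇒↭ₛ)
open import Data.List.Relation.Binary.Permutation.Propositional.Properties using (++⁺; ↭-reverse)
open import Relation.Binary.PropositionalEquality
  using (_≢_; refl; sym; trans; cong; cong₂; subst; subst₂; setoid; module ≡-Reasoning)
open import Data.List.Relation.Binary.Permutation.Setoid.Properties (setoid ℕ) using (Unique-resp-↭)
open import Data.List.Relation.Unary.Unique.Propositional using (Unique)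
open import Data.List.Relation.Unary.Unique.Propositional.Properties using (upTo⁺) renaming (map⁺ to Unique-map⁺)
open import Data.Product using (_,_; ∃₂)
open import Data.Sum using (_⊎_; inj₁; inj₂)
open import Data.Unit using (tt)
open import Function using (flip; id)
open import Function.Bundles using (mk⇔)
open import Relation.Nullary using (¬_; yes; no; contradiction)
open import Relation.Nullary.Decidable using (⌊_⌋)

BoolRel : Set
BoolRel = ℕ → ℕ → Bool

-- runs = splitBy ascent and falls = splitBy (flip ascent), definitionally.
ascent : BoolRel
ascent a b = ⌊ a <? b ⌋

ascent-true⇒< : ∀ {a b} → ascent a b ≡ true → a < b
ascent-true⇒< {a} {b} e with a <? b
... | yes a<b = a<b

ascent-false⇒≮ : ∀ {a b} → ascent a b ≡ false → ¬ (a < b)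
ascent-false⇒≮ {a} {b} e with a <? b
... | no a≮b = a≮b

≮⇒ascent-false : ∀ {a b} → ¬ (a < b) → ascent a b ≡ false
≮⇒ascent-false {a} {b} a≮b with a <? b
... | yes a<b = contradiction a<b a≮b
... | no _ = refl

-- First and last entry of a list (0 for the empty list, which never occurs
-- as a block).
headL : List ℕ → ℕ
headL []      = 0
headL (x ∷ _) = x

lastL : List ℕ → ℕ
lastL []           = 0
lastL (x ∷ [])     = x
lastL (x ∷ y ∷ ys) = lastL (y ∷ ys)

lastL-++ : ∀ xs y ys → lastL (xs ++ y ∷ ys) ≡ lastL (y ∷ ys)
lastL-++ []           y ys = refl
lastL-++ (x ∷ [])     y ys = refl
lastL-++ (x ∷ x′ ∷ xs) y ys = lastL-++ (x′ ∷ xs) y ys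

lastL-reverse : ∀ xs → lastL (reverse xs) ≡ headL xs
lastL-reverse []       = refl
lastL-reverse (x ∷ xs) = trans (cong lastL (unfold-reverse x xs)) (lastL-++ (reverse xs) x [])

headL-reverse : ∀ xs → headL (reverse xs) ≡ lastL xs
headL-reverse xs = sym (trans (cong lastL (sym (reverse-involutive xs))) (lastL-reverse (reverse xs)))

Chain : BoolRel → List ℕ → Set
Chain r = AllAdjacent (λ a b → r a b ≡ true)

data Block (r : BoolRel) : List ℕ → Set where
  block : ∀ {x xs} → Chain r (x ∷ xs) → Block r (x ∷ xs)

Separated : BoolRel → List (List ℕ) → Set
Separated r = AllAdjacent (λ C C′ → r (lastL C) (headL C′) ≡ false)

Boundary : (ℕ → ℕ → Set) → BoolRel → List ℕ → List ℕ → Set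
Boundary P r C C′ = P (lastL C) (headL C′) × r (lastL C) (headL C′) ≡ false

StartsWith : ℕ → List (List ℕ) → Set
StartsWith x gs = ∃₂ λ g gs′ → gs ≡ (x ∷ g) ∷ gs′

-- Prepending an entry to the first block (the private consFirst of Defs).
consToFirst : ℕ → List (List ℕ) → List (List ℕ)
consToFirst x []       = [ x ] ∷ []
consToFirst x (g ∷ gs) = (x ∷ g) ∷ gs

splitBy-starts : ∀ r x xs → StartsWith x (splitBy r (x ∷ xs))
splitBy-starts r x []       = [] , [] , refl
splitBy-starts r x (y ∷ ys) with r x y | splitBy-starts r y ys
... | true  | g , gs , eq rewrite eq = y ∷ g , gs , refl
... | false | _                      = [] , _ , refl

splitBy-join : ∀ r x y ys → r x y ≡ true →
               splitBy r (x ∷ y ∷ ys) ≡ consToFirst x (splitBy r (y ∷ ys))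
splitBy-join r x y ys e with r x y | splitBy-starts r y ys
... | true | g , gs , eq rewrite eq = refl

splitBy-cut : ∀ r x y ys → r x y ≡ false →
              splitBy r (x ∷ y ∷ ys) ≡ [ x ] ∷ splitBy r (y ∷ ys)
splitBy-cut r x y ys e with r x y
... | false = refl

SplitStep : BoolRel → ℕ → ℕ → List ℕ → Set
SplitStep r x y ys =
  (r x y ≡ true × splitBy r (x ∷ y ∷ ys) ≡ consToFirst x (splitBy r (y ∷ ys)))
  ⊎ (r x y ≡ false × splitBy r (x ∷ y ∷ ys) ≡ [ x ] ∷ splitBy r (y ∷ ys))

splitBy-step : ∀ r x y ys → SplitStep r x y ys
splitBy-step r x y ys = decide (r x y) refl
  where
    decide : ∀ b → r x y ≡ b → SplitStep r x y ys
    decide true  e = inj₁ (e , splitBy-join r x y ys e)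
    decide false e = inj₂ (e , splitBy-cut r x y ys e)

concat-splitBy : ∀ r xs → concat (splitBy r xs) ≡ xs
concat-splitBy r []           = refl
concat-splitBy r (x ∷ [])     = refl
concat-splitBy r (x ∷ y ∷ ys) with splitBy-step r x y ys | concat-splitBy r (y ∷ ys)
... | inj₁ (_ , joined) | ih = begin
    concat (splitBy r (x ∷ y ∷ ys))               ≡⟨ cong concat joined ⟩
    concat (consToFirst x (splitBy r (y ∷ ys)))   ≡⟨ concat-consToFirst (splitBy r (y ∷ ys)) ⟩
    x ∷ concat (splitBy r (y ∷ ys))               ≡⟨ cong (x ∷_) ih ⟩
    x ∷ y ∷ ys                                    ∎
  where
    open ≡-Reasoning
    concat-consToFirst : ∀ gs → concat (consToFirst x gs) ≡ x ∷ concat gs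
    concat-consToFirst []       = refl
    concat-consToFirst (g ∷ gs) = refl
... | inj₂ (_ , cut)    | ih = trans (cong concat cut) (cong (x ∷_) ih)

consToFirst-blocks : ∀ {r x y gs} → r x y ≡ true → StartsWith y gs →
                     All (Block r) gs → All (Block r) (consToFirst x gs)
consToFirst-blocks e (g , gs , refl) (block c ∷ bs) = block (e , c) ∷ bs

splitBy-blocks : ∀ r xs → All (Block r) (splitBy r xs)
splitBy-blocks r []           = []
splitBy-blocks r (x ∷ [])     = block tt ∷ []
splitBy-blocks r (x ∷ y ∷ ys) with splitBy-step r x y ys | splitBy-blocks r (y ∷ ys)
... | inj₁ (e , joined) | bs = subst (All (Block r)) (sym joined)
  (consToFirst-blocks e (splitBy-starts r y ys) bs)
... | inj₂ (_ , cut)    | bs = subst (All (Block r)) (sym cut) (block tt ∷ bs)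

consToFirst-boundaries : ∀ {P r x y gs} → StartsWith y gs →
  AllAdjacent (Boundary P r) gs → AllAdjacent (Boundary P r) (consToFirst x gs)
consToFirst-boundaries (g , []    , refl) _  = tt
consToFirst-boundaries (g , _ ∷ _ , refl) bs = bs

singleton-boundaries : ∀ {P r x y gs} → StartsWith y gs → P x y → r x y ≡ false →
  AllAdjacent (Boundary P r) gs → AllAdjacent (Boundary P r) ([ x ] ∷ gs)
singleton-boundaries (g , gs , refl) p e bs = (p , e) , bs

splitBy-boundaries : ∀ {P} r xs → AllAdjacent P xs → AllAdjacent (Boundary P r) (splitBy r xs)
splitBy-boundaries r []           _        = tt
splitBy-boundaries r (x ∷ [])     _        = tt
splitBy-boundaries {P} r (x ∷ y ∷ ys) (p , ps)
  with splitBy-step r x y ys | splitBy-boundaries r (y ∷ ys) ps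
... | inj₁ (_ , joined) | bs = subst (AllAdjacent (Boundary P r)) (sym joined)
  (consToFirst-boundaries {P} {r} {x} (splitBy-starts r y ys) bs)
... | inj₂ (e , cut)    | bs = subst (AllAdjacent (Boundary P r)) (sym cut)
  (singleton-boundaries {P} (splitBy-starts r y ys) p e bs)

splitBy-chain : ∀ {r x b} → Chain r (x ∷ b) → splitBy r (x ∷ b) ≡ (x ∷ b) ∷ []
splitBy-chain {b = []}     _        = refl
splitBy-chain {r} {x} {b₁ ∷ b} (c , cs) =
  trans (splitBy-join r x b₁ b c) (cong (consToFirst x) (splitBy-chain cs))

splitBy-join-chain : ∀ {r x b y t g gs} → Chain r (x ∷ b) → r (lastL (x ∷ b)) y ≡ true →
                     splitBy r (y ∷ t) ≡ g ∷ gs → splitBy r (x ∷ b ++ y ∷ t) ≡ (x ∷ b ++ g) ∷ gs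
splitBy-join-chain {r} {x} {[]} {y} {t} _ e eq =
  trans (splitBy-join r x y t e) (cong (consToFirst x) eq)
splitBy-join-chain {r} {x} {b₁ ∷ b} {y} {t} (c , cs) e eq =
  trans (splitBy-join r x b₁ (b ++ y ∷ t) c) (cong (consToFirst x) (splitBy-join-chain cs e eq))

splitBy-cut-chain : ∀ {r x b y t} → Chain r (x ∷ b) → r (lastL (x ∷ b)) y ≡ false →
                    splitBy r (x ∷ b ++ y ∷ t) ≡ (x ∷ b) ∷ splitBy r (y ∷ t)
splitBy-cut-chain {r} {x} {[]} {y} {t} _ e = splitBy-cut r x y t e
splitBy-cut-chain {r} {x} {b₁ ∷ b} {y} {t} (c , cs) e =
  trans (splitBy-join r x b₁ (b ++ y ∷ t) c) (cong (consToFirst x) (splitBy-cut-chain cs e))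

splitBy-concat : ∀ {r Cs} → All (Block r) Cs → Separated r Cs → splitBy r (concat Cs) ≡ Cs
splitBy-concat {r} [] _ = refl
splitBy-concat {r} (block {x} {b} c ∷ []) _ =
  trans (cong (splitBy r) (++-identityʳ (x ∷ b))) (splitBy-chain c)
splitBy-concat (block c ∷ block c′ ∷ bs) (e , sep) =
  trans (splitBy-cut-chain c e) (cong (_ ∷_) (splitBy-concat (block c′ ∷ bs) sep))

chain-snoc : ∀ {r} zs w → Chain r zs → r (lastL zs) w ≡ true → Chain r (zs ++ [ w ])
chain-snoc []            w _        _ = tt
chain-snoc (z ∷ [])      w _        e = e , tt
chain-snoc (z ∷ z′ ∷ zs) w (c , cs) e = c , chain-snoc (z′ ∷ zs) w cs e

chain-reverse : ∀ {r} xs → Chain r xs → Chain (flip r) (reverse xs)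
chain-reverse []           _        = tt
chain-reverse (x ∷ [])     _        = tt
chain-reverse {r} (x ∷ y ∷ ys) (c , cs) =
  subst (Chain (flip r)) (sym (unfold-reverse x (y ∷ ys)))
    (chain-snoc (reverse (y ∷ ys)) x (chain-reverse (y ∷ ys) cs)
      (subst (λ z → r x z ≡ true) (sym (lastL-reverse (y ∷ ys))) c))

block-reverse : ∀ {r xs} → Block r xs → Block (flip r) (reverse xs)
block-reverse {r} {x ∷ xs} (block c) =
  subst (Block (flip r)) (sym (unfold-reverse x xs))
    (snoc-block (reverse xs) (subst (Chain (flip r)) (unfold-reverse x xs) (chain-reverse (x ∷ xs) c)))
  where
    snoc-block : ∀ ys → Chain (flip r) (ys ++ [ x ]) → Block (flip r) (ys ++ [ x ])
    snoc-block []       c′ = block c′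
    snoc-block (y ∷ ys) c′ = block c′

blocks-reverse : ∀ {r Rs} → All (Block r) Rs → All (Block (flip r)) (map reverse Rs)
blocks-reverse []       = []
blocks-reverse (b ∷ bs) = block-reverse b ∷ blocks-reverse bs

increasing-above-head : ∀ {x xs} → Chain ascent (x ∷ xs) → All (x ≤_) xs
increasing-above-head {xs = []}     _        = []
increasing-above-head {x} {y ∷ ys} (c , cs) =
  <⇒≤ x<y ∷ All.map (≤-trans (<⇒≤ x<y)) (increasing-above-head cs)
  where
    x<y : x < y
    x<y = ascent-true⇒< c

increasing-below-last : ∀ {xs} → Chain ascent xs → All (_≤ lastL xs) xs
increasing-below-last {[]}         _        = []
increasing-below-last {x ∷ []}     _        = ≤-refl ∷ []
increasing-below-last {x ∷ y ∷ ys} (c , cs) with increasing-below-last cs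
... | y≤last ∷ rest = ≤-trans (<⇒≤ (ascent-true⇒< c)) y≤last ∷ y≤last ∷ rest

head≤last : ∀ {x xs} → Chain ascent (x ∷ xs) → x ≤ lastL (x ∷ xs)
head≤last c = All.head (increasing-below-last c)

foldr-⊓-bound : ∀ x xs → All (x ≤_) xs → foldr _⊓_ x xs ≡ x
foldr-⊓-bound x []       []         = refl
foldr-⊓-bound x (y ∷ ys) (x≤y ∷ ps) = trans (cong (y ⊓_) (foldr-⊓-bound x ys ps)) (m≥n⇒m⊓n≡n x≤y)

maxL-upper : ∀ x xs {y} → y ∈ x ∷ xs → y ≤ maxL (x ∷ xs)
maxL-upper x []       (here refl)         = ≤-refl
maxL-upper x (z ∷ zs) (here refl)         = ≤-trans (maxL-upper x zs (here refl)) (m≤n⊔m z _)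
maxL-upper x (z ∷ zs) (there (here refl)) = m≤m⊔n z _
maxL-upper x (z ∷ zs) (there (there p))   = ≤-trans (maxL-upper x zs (there p)) (m≤n⊔m z _)

maxL-least : ∀ {m} x xs → All (_≤ m) (x ∷ xs) → maxL (x ∷ xs) ≤ m
maxL-least x []       (p ∷ [])        = p
maxL-least x (z ∷ zs) (px ∷ pz ∷ pzs) = ⊔-lub pz (maxL-least x zs (px ∷ pzs))

lastL-∈ : ∀ x xs → lastL (x ∷ xs) ∈ x ∷ xs
lastL-∈ x []       = here refl
lastL-∈ x (y ∷ xs) = there (lastL-∈ y xs)

minL-increasing : ∀ {x xs} → Chain ascent (x ∷ xs) → minL (x ∷ xs) ≡ x
minL-increasing {x} {xs} c = foldr-⊓-bound x xs (increasing-above-head c)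

maxL-increasing : ∀ {x xs} → Chain ascent (x ∷ xs) → maxL (x ∷ xs) ≡ lastL (x ∷ xs)
maxL-increasing {x} {xs} c =
  ≤-antisym (maxL-least x xs (increasing-below-last c)) (maxL-upper x xs (lastL-∈ x xs))

HeadBelowLast : List ℕ → List ℕ → Set
HeadBelowLast R R′ = headL R < lastL R′

overlapping-increasing : ∀ {Rs} → All (Block ascent) Rs →
  AllAdjacent (λ R R′ → minL R < maxL R′) Rs ≡ AllAdjacent HeadBelowLast Rs
overlapping-increasing []                          = refl
overlapping-increasing (_ ∷ [])                    = refl
overlapping-increasing (block c ∷ block c′ ∷ bs) =
  cong₂ _×_ (cong₂ _<_ (minL-increasing c) (maxL-increasing c′))
            (overlapping-increasing (block c′ ∷ bs))

-- (⇐) Reversing the runs of an overlapping τ gives a preimage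

reverseRuns : List ℕ → List ℕ
reverseRuns τ = concat (map reverse (runs τ))

reversed-separated : ∀ Rs → AllAdjacent HeadBelowLast Rs → Separated (flip ascent) (map reverse Rs)
reversed-separated []            _        = tt
reversed-separated (_ ∷ [])      _        = tt
reversed-separated (R ∷ R′ ∷ Rs) (h<l , hs) = junction , reversed-separated (R′ ∷ Rs) hs
  where
    junction : ascent (headL (reverse R′)) (lastL (reverse R)) ≡ false
    junction rewrite headL-reverse R′ | lastL-reverse R = ≮⇒ascent-false (<⇒≯ h<l)

reverse-map-reverse : ∀ (Rs : List (List ℕ)) → map reverse (map reverse Rs) ≡ Rs
reverse-map-reverse []       = refl
reverse-map-reverse (R ∷ Rs) = cong₂ _∷_ (reverse-involutive R) (reverse-map-reverse Rs)

-- For overlapping τ the falls of reverseRuns τ are the reversed runs of τ,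
-- so flipping them restores τ.
T-reverseRuns : ∀ τ → AllRunsOverlapping τ → T (reverseRuns τ) ≡ τ
T-reverseRuns τ ov = begin
    concat (map reverse (falls (concat (map reverse Rs))))  ≡⟨ cong (λ Fs → concat (map reverse Fs)) falls-π ⟩
    concat (map reverse (map reverse Rs))                   ≡⟨ cong concat (reverse-map-reverse Rs) ⟩
    concat Rs                                               ≡⟨ concat-splitBy ascent τ ⟩
    τ                                                       ∎
  where
    open ≡-Reasoning
    Rs : List (List ℕ)
    Rs = runs τ
    blocks : All (Block ascent) Rs
    blocks = splitBy-blocks ascent τ
    falls-π : falls (concat (map reverse Rs)) ≡ map reverse Rs
    falls-π = splitBy-concat (blocks-reverse blocks)
      (reversed-separated Rs (subst id (overlapping-increasing blocks) ov))

reverseRuns-↭ : ∀ τ → reverseRuns τ ↭ τ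
reverseRuns-↭ τ = subst (reverseRuns τ ↭_) (concat-splitBy ascent τ) (reverse-each (runs τ))
  where
    reverse-each : ∀ (Rs : List (List ℕ)) → concat (map reverse Rs) ↭ concat Rs
    reverse-each []       = ↭-refl
    reverse-each (R ∷ Rs) = ++⁺ (↭-reverse R) (reverse-each Rs)

-- (⇒) The runs of T π overlap

lower-head : ∀ {x y g g′ Gs} → x ≤ y →
             AllAdjacent HeadBelowLast ((y ∷ g) ∷ Gs) → AllAdjacent HeadBelowLast ((x ∷ g′) ∷ Gs)
lower-head {Gs = []}    _   _          = tt
lower-head {Gs = _ ∷ _} x≤y (y<l , hs) = ≤-<-trans x≤y y<l , hs

runs-of-blocks : ∀ x b Bs → Chain ascent (x ∷ b) → All (Block ascent) Bs →
  AllAdjacent HeadBelowLast ((x ∷ b) ∷ Bs) →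
  ∃₂ λ g Gs → runs (concat ((x ∷ b) ∷ Bs)) ≡ (x ∷ g) ∷ Gs
            × lastL (x ∷ b) ≤ lastL (x ∷ g)
            × AllAdjacent HeadBelowLast ((x ∷ g) ∷ Gs)
runs-of-blocks x b [] c [] _ =
  b , [] , trans (cong runs (++-identityʳ (x ∷ b))) (splitBy-chain c) , ≤-refl , tt
runs-of-blocks x b (_ ∷ Bs) c (block {y} {c₀} c′ ∷ bs) (x<l , hs)
  with runs-of-blocks y c₀ Bs c′ bs hs
... | g , Gs , eq , l≤l′ , hs′ with ascent (lastL (x ∷ b)) y in e
... | true  = b ++ y ∷ g , Gs , splitBy-join-chain c e eq , l≤merged , lower-head (<⇒≤ x<y) hs′
  where
    l<y : lastL (x ∷ b) < y
    l<y = ascent-true⇒< e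
    x<y : x < y
    x<y = ≤-<-trans (head≤last c) l<y
    l≤merged : lastL (x ∷ b) ≤ lastL ((x ∷ b) ++ y ∷ g)
    l≤merged rewrite lastL-++ (x ∷ b) y g =
      ≤-trans (<⇒≤ l<y) (≤-trans (head≤last c′) l≤l′)
... | false = b , (y ∷ g) ∷ Gs , trans (splitBy-cut-chain c e) (cong ((x ∷ b) ∷_) eq)
            , ≤-refl , (<-≤-trans x<l l≤l′ , hs′)

runs-concat-blocks : ∀ {Bs} → All (Block ascent) Bs → AllAdjacent HeadBelowLast Bs →
                     AllAdjacent HeadBelowLast (runs (concat Bs))
runs-concat-blocks []                      _  = tt
runs-concat-blocks (block {x} {b} c ∷ bs) hs with runs-of-blocks x b _ c bs hs
... | g , Gs , eq , _ , hs′ = subst (AllAdjacent HeadBelowLast) (sym eq) hs′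

reversed-falls : ∀ Fs → AllAdjacent (Boundary _≢_ (flip ascent)) Fs →
                 AllAdjacent HeadBelowLast (map reverse Fs)
reversed-falls []            _ = tt
reversed-falls (_ ∷ [])      _ = tt
reversed-falls (F ∷ F′ ∷ Fs) ((l≢h , e) , bs) =
  subst₂ _<_ (sym (headL-reverse F)) (sym (lastL-reverse F′))
    (≤∧≢⇒< (≮⇒≥ (ascent-false⇒≮ e)) l≢h)
  , reversed-falls (F′ ∷ Fs) bs

T-overlapping : ∀ π → AllAdjacent _≢_ π → AllRunsOverlapping (T π)
T-overlapping π distinct =
  subst id (sym (overlapping-increasing (splitBy-blocks ascent (T π))))
    (runs-concat-blocks (blocks-reverse (splitBy-blocks (flip ascent) π))
      (reversed-falls (falls π) (splitBy-boundaries (flip ascent) π distinct)))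

permutation-unique : ∀ {n π} → IsPerm n π → Unique π
permutation-unique {n} p = Unique-resp-↭ (↭⇒↭ₛ (↭-sym p)) (Unique-map⁺ suc-injective (upTo⁺ n))

unique-adjacent : ∀ {xs : List ℕ} → Unique xs → AllAdjacent _≢_ xs
unique-adjacent {[]}         _              = tt
unique-adjacent {x ∷ []}     _              = tt
unique-adjacent {x ∷ y ∷ ys} ((x≢y ∷ _) ∷ u) = x≢y , unique-adjacent u

theorem3 : (n : ℕ) → 1 ≤ n → (τ : List ℕ) → IsPerm n τ →
    (∃ λ (π : List ℕ) → IsPerm n π × T π ≡ τ) ⇔ AllRunsOverlapping τ
theorem3 n _ τ τ-perm = mk⇔ forward backward
  where
    forward : (∃ λ π → IsPerm n π × T π ≡ τ) → AllRunsOverlapping τ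
    forward (π , π-perm , Tπ≡τ) =
      subst AllRunsOverlapping Tπ≡τ (T-overlapping π (unique-adjacent (permutation-unique π-perm)))
    backward : AllRunsOverlapping τ → ∃ λ π → IsPerm n π × T π ≡ τ
    backward ov = reverseRuns τ , ↭-trans (reverseRuns-↭ τ) τ-perm , T-reverseRuns τ ov
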